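{- Let $\Lambda=(B,K,\Theta)$ be a signature. (1) A bottomed $\Lambda$-algebra is a $\diamond^\bot$-algebra if and only if it is the flat bottomed extension of some $\Lambda$-algebra. (2) A bottomed $\Lambda$-algebra $(X,p)$ is a $\diamond^\natural$-algebra if and only if $p_k(v)\neq\bot_{\overline{k}}$ for all $v\in[X]_{\underline{k}}$ and all $k\in K$; in particular, each strictly regular bottomed $\Lambda$-algebra is a $\diamond^\natural$-algebra.
   Context: A signature is a triple $\Lambda=(B,K,\Theta)$ with $B,K$ non-empty sets and $\Theta$ assigning to each $k\in K$ a pair $(\underline{k},\overline{k})$, $\overline{k}\in B$, $\underline{k}:D_k\to B$ with $D_k$ finite. $K_b=\{k:\overline{k}=b\}$; parameter set $A=\{b:K_b=\emptyset\}$. For a $B$-family of sets $X$ and $\gamma:I\to B$ ($I$ finite), $[X]_\gamma$ is the set of maps $v$ on $I$ with $v(\eta)\in X_{\gamma(\eta)}$; for maps $\pi_b:X_b\to Y_b$, $[\pi]_\gamma(v)(\eta)=\pi_{\gamma(\eta)}(v(\eta))$. A $\Lambda$-algebra is $(Y,q)$ with $Y$ a $B$-family of sets and maps $q_k:[Y]_{\underline{k}}\to Y_{\overline{k}}$. A bottomed set is a set with a distinguished element $\bot$; a map is bottomed if it preserves bottoms and proper if moreover it maps non-bottom elements to non-bottom elements. A bottomed $\Lambda$-algebra is $(X,p)$ with $X$ a $B$-family of bottomed sets (bottoms $\bot_b$) and arbitrary maps $p_k:[X]_{\underline{k}}\to X_{\overline{k}}$; a bottomed homomorphism is a family of bottomed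 maps $\pi_b$ with $q_k\circ[\pi]_{\underline{k}}=\pi_{\overline{k}}\circ p_k$. Given a $\Lambda$-algebra $(Y,q)$ and elements $\bot_b\notin Y_b$, its flat bottomed extension is $(Y^\bot,q^\bot)$ with $Y^\bot_b=Y_b\cup\{\bot_b\}$ (bottom $\bot_b$) and $q^\bot_k(v)=q_k(v)$ if $v\in[Y]_{\underline{k}}$, $q^\bot_k(v)=\bot_{\overline{k}}$ otherwise. Let $\mathbb{T}=\{\bot,\natural\}$ be bottomed with bottom $\bot$. The simple head types $\diamond^\bot$ and $\diamond^\natural$ are the bottomed $\Lambda$-algebras $(H,\diamond^\bot)$, $(H,\diamond^\natural)$ with $H_b=\mathbb{T}$ for all $b\in B$, where $\diamond^\bot_k(v)=\natural$ if $v(\eta)=\natural$ for all $\eta\in D_k$ and $\diamond^\bot_k(v)=\bot$ otherwise, and $\diamond^\natural_k(v)=\natural$ for all $v$. A bottomed $\Lambda$-algebra is a $\diamond$-algebra (for $\diamond$ one of these) if there is a bottomed homomorphism from it to $(H,\diamond)$ with all components proper. A bottomed $\Lambda$-algebra $(X,p)$ is strictly regular if each $p_k$ is injective and, for each $b\in B\setminus A$, the sets $\mathrm{Im}(p_k)$, $k\in K_b$, form a partition of $X_b\setminus\{\bot_b\}$. -}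

module Defs where

open import Data.Nat using (ℕ; zero; suc)
open import Data.Fin using (Fin; zero; suc)
open import Data.Fin.Properties using (all?)
open import Data.Maybe using (Maybe; just; nothing; maybe)
open import Data.Product using (Σ; _×_; _,_)
open import Relation.Nullary using (¬_; Dec; yes; no; does)
open import Relation.Binary.PropositionalEquality using (_≡_; _≢_; refl; subst)
open import Function.Bundles using (_↔_; Inverse)
open import Data.Bool using (if_then_else_)

-- A signature Λ = (B, K, Θ).  The finite domain D_k is represented by Fin (ar k);
-- dom k = k̲ : D_k → B and cod k = k̄ ∈ B.  B and K are non-empty.
record Signature : Set₁ where
  field
    B   : Set
    K   : Set
    b₀  : B
    k₀  : K
    ar  : K → ℕ
    dom : (k : K) → Fin (ar k) → B
    cod : K → B

module _ (Λ : Signature) where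
  open Signature Λ

  Args : (B → Set) → K → Set
  Args X k = (i : Fin (ar k)) → X (dom k i)

  mapArgs : {X Y : B → Set} → ((b : B) → X b → Y b) → (k : K) → Args X k → Args Y k
  mapArgs π k v i = π (dom k i) (v i)

  Kb : B → Set
  Kb b = Σ K (λ k → cod k ≡ b)

  InA : B → Set
  InA b = ¬ Kb b

  record Algebra : Set₁ where
    field
      Car : B → Set
      op  : (k : K) → Args Car k → Car (cod k)

  record BAlgebra : Set₁ where
    field
      Car : B → Set
      bot : (b : B) → Car b
      op  : (k : K) → Args Car k → Car (cod k)

  open BAlgebra

  IsBHom : (X Z : BAlgebra) → ((b : B) → Car X b → Car Z b) → Set
  IsBHom X Z π =
    ((b : B) → π b (bot X b) ≡ bot Z b) ×
    ((k : K) (v : Args (Car X) k) → op Z k (mapArgs π k v) ≡ π (cod k) (op X k v))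

  -- proper (bottomed and non-bottom to non-bottom); the bottomed part is in IsBHom
  IsProper : (X Z : BAlgebra) → ((b : B) → Car X b → Car Z b) → Set
  IsProper X Z π = (b : B) (x : Car X b) → x ≢ bot X b → π b x ≢ bot Z b

  collect : {n : ℕ} {Y : Fin n → Set} → ((i : Fin n) → Maybe (Y i)) → Maybe ((i : Fin n) → Y i)
  collect {zero} f = just (λ ())
  collect {suc n} {Y} f with f zero | collect {n} {λ i → Y (suc i)} (λ i → f (suc i))
  ... | just a | just g = just (λ { zero → a ; (suc i) → g i })
  ... | just a | nothing = nothing
  ... | nothing | _ = nothing

  -- flat bottomed extension (Y^⊥ , q^⊥), with Y_b ∪ {⊥_b} realised as Maybe (Y b)
  flatExt : Algebra → BAlgebra
  flatExt Y = record
    { Car = λ b → Maybe (Algebra.Car Y b)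
    ; bot = λ b → nothing
    ; op  = λ k v → maybe (λ w → just (Algebra.op Y k w)) nothing (collect v)
    }

  -- "X is the flat bottomed extension of some Λ-algebra" (up to isomorphism of bottomed algebras)
  IsFlatExtension : BAlgebra → Set₁
  IsFlatExtension X =
    Σ Algebra λ Y →
    Σ ((b : B) → Car X b ↔ Maybe (Algebra.Car Y b)) λ π →
      IsBHom X (flatExt Y) (λ b → Inverse.to (π b))

  data 𝕋 : Set where
    ⊥T ♮ : 𝕋

  _≟T_ : (x y : 𝕋) → Dec (x ≡ y)
  ⊥T ≟T ⊥T = yes refl
  ⊥T ≟T ♮ = no (λ ())
  ♮ ≟T ⊥T = no (λ ())
  ♮ ≟T ♮ = yes refl

  HeadOp : Set
  HeadOp = (k : K) → (Fin (ar k) → 𝕋) → 𝕋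

  ◇⊥ : HeadOp
  ◇⊥ k v = if does (all? (λ i → v i ≟T ♮)) then ♮ else ⊥T

  ◇♮ : HeadOp
  ◇♮ k v = ♮

  Head : HeadOp → BAlgebra
  Head ◇ = record { Car = λ _ → 𝕋 ; bot = λ _ → ⊥T ; op = ◇ }

  Is◇Algebra : HeadOp → BAlgebra → Set
  Is◇Algebra ◇ X =
    Σ ((b : B) → Car X b → 𝕋) λ π → IsBHom X (Head ◇) π × IsProper X (Head ◇) π

  StrictlyRegular : BAlgebra → Set
  StrictlyRegular X =
    ((k : K) (v w : Args (Car X) k) → op X k v ≡ op X k w → (i : Fin (ar k)) → v i ≡ w i) ×
    -- for b ∉ A, the images Im(p_k), k ∈ K_b, partition X_b \ {⊥_b}
    ((b : B) → ¬ InA b →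
      (((ke : Kb b) (v : Args (Car X) (Σ.proj₁ ke)) →
          subst (Car X) (Σ.proj₂ ke) (op X (Σ.proj₁ ke) v) ≢ bot X b) ×
       ((x : Car X b) → x ≢ bot X b →
          Σ (Kb b) λ ke → Σ (Args (Car X) (Σ.proj₁ ke)) λ v →
            subst (Car X) (Σ.proj₂ ke) (op X (Σ.proj₁ ke) v) ≡ x) ×
       ((ke ke′ : Kb b) (v : Args (Car X) (Σ.proj₁ ke)) (v′ : Args (Car X) (Σ.proj₁ ke′)) →
          subst (Car X) (Σ.proj₂ ke) (op X (Σ.proj₁ ke) v) ≡
          subst (Car X) (Σ.proj₂ ke′) (op X (Σ.proj₁ ke′) v′) →
          Σ.proj₁ ke ≡ Σ.proj₁ ke′)))

module Submission where

open import Defs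
open import Level using (0ℓ)
open import Data.Product using (_×_)
open import Function.Bundles using (_⇔_)
open import Relation.Binary.PropositionalEquality using (_≢_)
open import Axiom.ExcludedMiddle using (ExcludedMiddle)
open import Axiom.Extensionality.Propositional using (Extensionality)

open import Data.Nat using (ℕ; zero; suc)
open import Data.Fin using (Fin; zero; suc)
open import Data.Fin.Properties using (all?)
open import Data.Maybe using (Maybe; just; nothing)
open import Data.Product using (Σ; _,_; proj₁; proj₂)
open import Data.Empty using (⊥-elim)
open import Function using (_∘_)
open import Function.Bundles using (_↔_; Inverse; mk⇔; mk↔ₛ′)
open import Relation.Nullary using (¬_; yes; no)
open import Relation.Nullary.Decidable using (dec-true; dec-false; decidable-stable)
open import Relation.Binary.PropositionalEquality using (_≡_; refl; sym; trans; cong; module ≡-Reasoning)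

-- A proper bottomed map into 𝕋 sends x to ♮ exactly when x ≠ ⊥ (classically). So X is a
-- ◇⊥-algebra iff every p_k is strict and sends defined arguments to defined values, which is
-- exactly what makes X the flat extension of the algebra of its non-bottom elements; and X is
-- a ◇♮-algebra iff no p_k ever returns ⊥.

module FlatExtensions (Λ : Signature) where
  open Signature Λ
  open BAlgebra
  open ≡-Reasoning

  collect-just : {n : ℕ} {Y : Fin n → Set} (f : (i : Fin n) → Maybe (Y i)) (g : (i : Fin n) → Y i) →
                 collect Λ f ≡ just g → ∀ i → f i ≡ just (g i)
  collect-just {suc n} {Y} f g with f zero in f₀≡ | collect Λ {n} {Y ∘ suc} (f ∘ suc) in rest≡
  ... | just _ | just _ = λ { refl zero → f₀≡ ; refl (suc i) → collect-just (f ∘ suc) _ rest≡ i }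

  collect-nothing : {n : ℕ} {Y : Fin n → Set} (f : (i : Fin n) → Maybe (Y i)) →
                    collect Λ f ≡ nothing → Σ (Fin n) λ i → f i ≡ nothing
  collect-nothing {suc n} {Y} f with f zero in f₀≡ | collect Λ {n} {Y ∘ suc} (f ∘ suc) in rest≡
  ... | just _  | nothing = λ _ → let i , fᵢ≡ = collect-nothing (f ∘ suc) rest≡ in suc i , fᵢ≡
  ... | nothing | _       = λ _ → zero , f₀≡

  ♮≢⊥T : ♮ {Λ} ≢ ⊥T
  ♮≢⊥T ()

  ≢⊥T⇒≡♮ : {t : 𝕋 Λ} → t ≢ ⊥T → t ≡ ♮
  ≢⊥T⇒≡♮ {⊥T} t≢⊥T = ⊥-elim (t≢⊥T refl)
  ≢⊥T⇒≡♮ {♮}  _    = refl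

  ◇⊥-all♮ : (k : K) {u : Fin (ar k) → 𝕋 Λ} → (∀ i → u i ≡ ♮) → ◇⊥ Λ k u ≡ ♮
  ◇⊥-all♮ k {u} all♮ rewrite dec-true (all? λ i → _≟T_ Λ (u i) ♮) all♮ = refl

  ◇⊥-some⊥ : (k : K) {u : Fin (ar k) → 𝕋 Λ} (i : Fin (ar k)) → u i ≡ ⊥T → ◇⊥ Λ k u ≡ ⊥T
  ◇⊥-some⊥ k {u} i uᵢ≡⊥T rewrite dec-false (all? λ i → _≟T_ Λ (u i) ♮) λ all♮ → ♮≢⊥T (trans (sym (all♮ i)) uᵢ≡⊥T) = refl

  IsBHom-∘ : {X Y Z : BAlgebra Λ} {g : (b : B) → Car Y b → Car Z b} {f : (b : B) → Car X b → Car Y b} →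
             IsBHom Λ Y Z g → IsBHom Λ X Y f → IsBHom Λ X Z (λ b → g b ∘ f b)
  IsBHom-∘ {g = g} {f} (g-bot , g-hom) (f-bot , f-hom) =
    (λ b → trans (cong (g b) (f-bot b)) (g-bot b)) ,
    (λ k v → trans (g-hom k (mapArgs Λ f k v)) (cong (g (cod k)) (f-hom k v)))

  IsProper-∘ : {X Y Z : BAlgebra Λ} {g : (b : B) → Car Y b → Car Z b} {f : (b : B) → Car X b → Car Y b} →
               IsProper Λ Y Z g → IsProper Λ X Y f → IsProper Λ X Z (λ b → g b ∘ f b)
  IsProper-∘ {f = f} g-proper f-proper b x x≢bot = g-proper b (f b x) (f-proper b x x≢bot)

  Is◇Algebra-pullback : (◇ : HeadOp Λ) {X Z : BAlgebra Λ} {h : (b : B) → Car X b → Car Z b} →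
                        IsBHom Λ X Z h → IsProper Λ X Z h → Is◇Algebra Λ ◇ Z → Is◇Algebra Λ ◇ X
  Is◇Algebra-pullback ◇ {X} {Z} {h} h-hom h-proper (π , π-hom , π-proper) =
    (λ b → π b ∘ h b) ,
    IsBHom-∘ {X} {Z} {Head Λ ◇} {π} {h} π-hom h-hom ,
    IsProper-∘ {X} {Z} {Head Λ ◇} {π} {h} π-proper h-proper

  inverse-bottomed⇒proper : {X Z : BAlgebra Λ} (π : (b : B) → Car X b ↔ Car Z b) →
                            ((b : B) → Inverse.to (π b) (bot X b) ≡ bot Z b) →
                            IsProper Λ X Z (λ b → Inverse.to (π b))
  inverse-bottomed⇒proper {X} {Z} π π-bot b x x≢bot to-x≡bot = x≢bot (begin
    x                    ≡⟨ sym (strictlyInverseʳ x) ⟩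
    from (to x)          ≡⟨ cong from (trans to-x≡bot (sym (π-bot b))) ⟩
    from (to (bot X b))  ≡⟨ strictlyInverseʳ (bot X b) ⟩
    bot X b              ∎)
    where open Inverse (π b)

  isJustᵀ : {A : Set} → Maybe A → 𝕋 Λ
  isJustᵀ (just _) = ♮
  isJustᵀ nothing  = ⊥T

  flatExt-is◇⊥Algebra : (Y : Algebra Λ) → Is◇Algebra Λ (◇⊥ Λ) (flatExt Λ Y)
  flatExt-is◇⊥Algebra Y = ρ , ((λ _ → refl) , hom) , proper
    where
    Y⊥ : B → Set
    Y⊥ = Car (flatExt Λ Y)

    ρ : (b : B) → Y⊥ b → 𝕋 Λ
    ρ _ = isJustᵀ

    hom : (k : K) (v : Args Λ Y⊥ k) →
          ◇⊥ Λ k (mapArgs Λ ρ k v) ≡ ρ (cod k) (op (flatExt Λ Y) k v)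
    hom k v with collect Λ v in collect≡
    ... | just w  = ◇⊥-all♮ k λ i → cong isJustᵀ (collect-just v w collect≡ i)
    ... | nothing = let i , vᵢ≡ = collect-nothing v collect≡ in ◇⊥-some⊥ k i (cong isJustᵀ vᵢ≡)

    proper : IsProper Λ (flatExt Λ Y) (Head Λ (◇⊥ Λ)) ρ
    proper b (just _) _ ()
    proper b nothing nothing≢nothing = ⊥-elim (nothing≢nothing refl)

  IsFlatExtension⇒◇⊥Algebra : (X : BAlgebra Λ) → IsFlatExtension Λ X → Is◇Algebra Λ (◇⊥ Λ) X
  IsFlatExtension⇒◇⊥Algebra X (Y , π , π-hom) =
    Is◇Algebra-pullback (◇⊥ Λ) π-hom (inverse-bottomed⇒proper {X} {flatExt Λ Y} π (proj₁ π-hom)) (flatExt-is◇⊥Algebra Y)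

  Strict : BAlgebra Λ → Set
  Strict X = (k : K) (v : Args Λ (Car X) k) (i : Fin (ar k)) →
             v i ≡ bot X (dom k i) → op X k v ≡ bot X (cod k)

  DefinednessPreserving : BAlgebra Λ → Set
  DefinednessPreserving X = (k : K) (v : Args Λ (Car X) k) →
                            (∀ i → v i ≢ bot X (dom k i)) → op X k v ≢ bot X (cod k)

  ◇⊥Algebra⇒DefinednessPreserving : (X : BAlgebra Λ) → Is◇Algebra Λ (◇⊥ Λ) X → DefinednessPreserving X
  ◇⊥Algebra⇒DefinednessPreserving X (π , (π-bot , π-hom) , π-proper) k v v≢bot op≡bot = ♮≢⊥T (begin
    ♮                          ≡⟨ sym (◇⊥-all♮ k λ i → ≢⊥T⇒≡♮ (π-proper _ (v i) (v≢bot i))) ⟩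
    ◇⊥ Λ k (mapArgs Λ π k v)   ≡⟨ π-hom k v ⟩
    π (cod k) (op X k v)       ≡⟨ cong (π (cod k)) op≡bot ⟩
    π (cod k) (bot X (cod k))  ≡⟨ π-bot (cod k) ⟩
    ⊥T                         ∎)

  ◇♮Algebra⇒op≢bot : (X : BAlgebra Λ) → Is◇Algebra Λ (◇♮ Λ) X →
                     (k : K) (v : Args Λ (Car X) k) → op X k v ≢ bot X (cod k)
  ◇♮Algebra⇒op≢bot X (π , (π-bot , π-hom) , _) k v op≡bot = ♮≢⊥T (begin
    ♮                          ≡⟨ π-hom k v ⟩
    π (cod k) (op X k v)       ≡⟨ cong (π (cod k)) op≡bot ⟩
    π (cod k) (bot X (cod k))  ≡⟨ π-bot (cod k) ⟩
    ⊥T                         ∎)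

  StrictlyRegular⇒op≢bot : (X : BAlgebra Λ) → StrictlyRegular Λ X →
                           (k : K) (v : Args Λ (Car X) k) → op X k v ≢ bot X (cod k)
  StrictlyRegular⇒op≢bot X (_ , partition) k =
    proj₁ (partition (cod k) λ cod-k∈A → cod-k∈A (k , refl)) (k , refl)

  module _ (lem : ExcludedMiddle 0ℓ) where

    ◇⊥Algebra⇒Strict : (X : BAlgebra Λ) → Is◇Algebra Λ (◇⊥ Λ) X → Strict X
    ◇⊥Algebra⇒Strict X (π , (π-bot , π-hom) , π-proper) k v i vᵢ≡bot =
      decidable-stable lem λ op≢bot → π-proper (cod k) (op X k v) op≢bot (begin
        π (cod k) (op X k v)      ≡⟨ sym (π-hom k v) ⟩
        ◇⊥ Λ k (mapArgs Λ π k v)  ≡⟨ ◇⊥-some⊥ k i (trans (cong (π (dom k i)) vᵢ≡bot) (π-bot (dom k i))) ⟩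
        ⊥T                        ∎)

    definedness : (X : BAlgebra Λ) (b : B) → Car X b → 𝕋 Λ
    definedness X b x with lem {x ≡ bot X b}
    ... | yes _ = ⊥T
    ... | no _  = ♮

    definedness-bot : (X : BAlgebra Λ) (b : B) → definedness X b (bot X b) ≡ ⊥T
    definedness-bot X b with lem {bot X b ≡ bot X b}
    ... | yes _       = refl
    ... | no bot≢bot  = ⊥-elim (bot≢bot refl)

    definedness-≢bot : (X : BAlgebra Λ) (b : B) {x : Car X b} → x ≢ bot X b → definedness X b x ≡ ♮
    definedness-≢bot X b {x} x≢bot with lem {x ≡ bot X b}
    ... | yes x≡bot = ⊥-elim (x≢bot x≡bot)
    ... | no _      = refl

    op≢bot⇒◇♮Algebra : (X : BAlgebra Λ) → ((k : K) (v : Args Λ (Car X) k) → op X k v ≢ bot X (cod k)) →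
                       Is◇Algebra Λ (◇♮ Λ) X
    op≢bot⇒◇♮Algebra X op≢bot =
      definedness X ,
      (definedness-bot X , λ k v → sym (definedness-≢bot X (cod k) (op≢bot k v))) ,
      λ b x x≢bot → ♮≢⊥T ∘ trans (sym (definedness-≢bot X b x≢bot))

    module _ (ext : Extensionality 0ℓ 0ℓ) where

      ¬-irrelevant : {P : Set} (f g : ¬ P) → f ≡ g
      ¬-irrelevant f g = ext λ p → ⊥-elim (f p)

      Defined : BAlgebra Λ → B → Set
      Defined X b = Σ (Car X b) λ x → x ≢ bot X b

      definedAlgebra : (X : BAlgebra Λ) → DefinednessPreserving X → Algebra Λ
      definedAlgebra X preserving = record
        { Car = Defined X
        ; op  = λ k w → op X k (proj₁ ∘ w) , preserving k (proj₁ ∘ w) (proj₂ ∘ w)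
        }

      module _ (X : BAlgebra Λ) where

        toMaybe : (b : B) → Car X b → Maybe (Defined X b)
        toMaybe b x with lem {x ≡ bot X b}
        ... | yes _     = nothing
        ... | no x≢bot  = just (x , x≢bot)

        fromMaybe : (b : B) → Maybe (Defined X b) → Car X b
        fromMaybe b nothing        = bot X b
        fromMaybe b (just (x , _)) = x

        toMaybe-bot : (b : B) → toMaybe b (bot X b) ≡ nothing
        toMaybe-bot b with lem {bot X b ≡ bot X b}
        ... | yes _      = refl
        ... | no bot≢bot = ⊥-elim (bot≢bot refl)

        toMaybe-defined : (b : B) (x : Car X b) (x≢bot : x ≢ bot X b) → toMaybe b x ≡ just (x , x≢bot)
        toMaybe-defined b x x≢bot with lem {x ≡ bot X b}
        ... | yes x≡bot = ⊥-elim (x≢bot x≡bot)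
        ... | no x≢bot′ = cong (λ p → just (x , p)) (¬-irrelevant x≢bot′ x≢bot)

        fromMaybe-toMaybe : (b : B) (x : Car X b) → fromMaybe b (toMaybe b x) ≡ x
        fromMaybe-toMaybe b x with lem {x ≡ bot X b}
        ... | yes x≡bot = sym x≡bot
        ... | no _      = refl

        toMaybe≡⇒fromMaybe≡ : (b : B) {x : Car X b} {m : Maybe (Defined X b)} →
                              toMaybe b x ≡ m → fromMaybe b m ≡ x
        toMaybe≡⇒fromMaybe≡ b {x} refl = fromMaybe-toMaybe b x

        toMaybe-fromMaybe : (b : B) (m : Maybe (Defined X b)) → toMaybe b (fromMaybe b m) ≡ m
        toMaybe-fromMaybe b nothing             = toMaybe-bot b
        toMaybe-fromMaybe b (just (x , x≢bot))  = toMaybe-defined b x x≢bot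

        Strict∧DefinednessPreserving⇒IsFlatExtension :
          Strict X → (preserving : DefinednessPreserving X) → IsFlatExtension Λ X
        Strict∧DefinednessPreserving⇒IsFlatExtension strict preserving =
          Y , (λ b → mk↔ₛ′ (toMaybe b) (fromMaybe b) (toMaybe-fromMaybe b) (fromMaybe-toMaybe b)) ,
          (toMaybe-bot , hom)
          where
          Y : Algebra Λ
          Y = definedAlgebra X preserving

          hom : (k : K) (v : Args Λ (Car X) k) →
                op (flatExt Λ Y) k (mapArgs Λ toMaybe k v) ≡ toMaybe (cod k) (op X k v)
          hom k v with collect Λ (mapArgs Λ toMaybe k v) in collect≡
          ... | just w = begin
            just (Algebra.op Y k w)               ≡⟨ sym (toMaybe-defined (cod k) _ _) ⟩
            toMaybe (cod k) (op X k (proj₁ ∘ w))  ≡⟨ cong (toMaybe (cod k) ∘ op X k) (ext λ i →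
                                                     toMaybe≡⇒fromMaybe≡ (dom k i) (collect-just _ w collect≡ i)) ⟩
            toMaybe (cod k) (op X k v)            ∎
          ... | nothing = let i , vᵢ↦nothing = collect-nothing _ collect≡ in begin
            nothing                               ≡⟨ sym (toMaybe-bot (cod k)) ⟩
            toMaybe (cod k) (bot X (cod k))       ≡⟨ cong (toMaybe (cod k))
                                                     (sym (strict k v i (sym (toMaybe≡⇒fromMaybe≡ (dom k i) vᵢ↦nothing)))) ⟩
            toMaybe (cod k) (op X k v)            ∎

      ◇⊥Algebra⇒IsFlatExtension : (X : BAlgebra Λ) → Is◇Algebra Λ (◇⊥ Λ) X → IsFlatExtension Λ X
      ◇⊥Algebra⇒IsFlatExtension X ◇⊥X =
        Strict∧DefinednessPreserving⇒IsFlatExtension X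
          (◇⊥Algebra⇒Strict X ◇⊥X) (◇⊥Algebra⇒DefinednessPreserving X ◇⊥X)

proposition3p3p3 : ExcludedMiddle 0ℓ → Extensionality 0ℓ 0ℓ →
    (Λ : Signature) →
    ((X : BAlgebra Λ) → Is◇Algebra Λ (◇⊥ Λ) X ⇔ IsFlatExtension Λ X) ×
    ((X : BAlgebra Λ) → Is◇Algebra Λ (◇♮ Λ) X ⇔
      ((k : Signature.K Λ) (v : Args Λ (BAlgebra.Car X) k) →
        BAlgebra.op X k v ≢ BAlgebra.bot X (Signature.cod Λ k))) ×
    ((X : BAlgebra Λ) → StrictlyRegular Λ X → Is◇Algebra Λ (◇♮ Λ) X)
proposition3p3p3 lem ext Λ =
  (λ X → mk⇔ (◇⊥Algebra⇒IsFlatExtension lem ext X) (IsFlatExtension⇒◇⊥Algebra X)) ,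
  (λ X → mk⇔ (◇♮Algebra⇒op≢bot X) (op≢bot⇒◇♮Algebra lem X)) ,
  (λ X → op≢bot⇒◇♮Algebra lem X ∘ StrictlyRegular⇒op≢bot X)
  where open FlatExtensions Λ
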